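{- Let $M$ be a supersolvable matroid. Any two $M$-chains of $M$ are equivalent, i.e., one can be obtained from the other by a finite sequence of elementary deformations.
   Context: A pair of flats $F,F'$ of a matroid is modular if $r(F)+r(F')=r(F\vee F')+r(F\wedge F')$; a flat is modular if it forms a modular pair with every flat. A matroid $M$ of rank $r$ on $[n]$ is supersolvable if there is a maximal chain of modular flats $\emptyset=F_0\subsetneq\dots\subsetneq F_r=[n]$; such a chain is an $M$-chain. Two $M$-chains are related by an elementary deformation if they differ in at most one flat; two $M$-chains are equivalent if one can be obtained from the other by a sequence of elementary deformations. -}

module Defs where

open import Data.Nat using (ℕ; suc; _+_; _≤_; _<_)
open import Data.Nat.Properties using (_≟_)
open import Data.Fin using (Fin; zero; suc; fromℕ; inject₁)
open import Data.Fin.Subset using (Subset; _∈_; _∉_; _⊆_; _⊂_; _∪_; _∩_; ⁅_⁆; ∣_∣; ⊥; ⊤)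
open import Data.Vec using (tabulate)
open import Data.Product using (Σ; ∃; _×_)
open import Relation.Nullary using (¬_)
open import Relation.Nullary.Decidable using (⌊_⌋)
open import Relation.Binary.PropositionalEquality using (_≡_; _≢_)
open import Relation.Binary.Construct.Closure.ReflexiveTransitive using (Star)

record Matroid (n : ℕ) : Set where
  field
    r          : Subset n → ℕ
    r-bounded  : ∀ X → r X ≤ ∣ X ∣
    r-mono     : ∀ {X Y} → X ⊆ Y → r X ≤ r Y
    r-submod   : ∀ X Y → r (X ∪ Y) + r (X ∩ Y) ≤ r X + r Y

module _ {n : ℕ} (M : Matroid n) where
  open Matroid M

  rank : ℕ
  rank = r ⊤

  cl : Subset n → Subset n
  cl X = tabulate λ e → ⌊ r (X ∪ ⁅ e ⁆) ≟ r X ⌋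

  IsFlat : Subset n → Set
  IsFlat F = ∀ e → e ∉ F → r F < r (F ∪ ⁅ e ⁆)

  _∨F_ : Subset n → Subset n → Subset n
  F ∨F G = cl (F ∪ G)

  _∧F_ : Subset n → Subset n → Subset n
  F ∧F G = F ∩ G

  ModularPair : Subset n → Subset n → Set
  ModularPair F G = r F + r G ≡ r (F ∨F G) + r (F ∧F G)

  IsModularFlat : Subset n → Set
  IsModularFlat F = IsFlat F × (∀ G → IsFlat G → ModularPair F G)

  Covers : Subset n → Subset n → Set
  Covers F G = F ⊂ G × (∀ H → IsFlat H → F ⊂ H → H ⊂ G → Data.Empty.⊥)
    where import Data.Empty

  record MChain : Set where
    field
      F         : Fin (suc rank) → Subset n
      modular   : ∀ i → IsModularFlat (F i)
      bottom    : F zero ≡ ⊥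
      top       : F (fromℕ rank) ≡ ⊤
      covering  : ∀ (i : Fin rank) → Covers (F (inject₁ i)) (F (suc i))
  open MChain public

  Supersolvable : Set
  Supersolvable = MChain

  ElementaryDeformation : MChain → MChain → Set
  ElementaryDeformation C C' = ∃ λ (j : Fin (suc rank)) → ∀ i → i ≢ j → F C i ≡ F C' i

  Equivalent : MChain → MChain → Set
  Equivalent = Star ElementaryDeformation

-- Induction on the highest rank at which two M-chains differ. Suppose they agree above
-- K = k + 1 but F_K ≠ F′_K. Both are covered by F_{K+1}, so H = F_K ∩ F′_K is a modular flat
-- (meets of modular flats are modular) of rank k. Intersecting the first chain with H gives
-- modular flats of ranks 0, …, k inside H; grafting them under F_K and under F′_K yields two
-- M-chains that differ only at K, each agreeing above rank k with the chain it was grafted into.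

module Submission where

open import Defs
open import Data.Nat using (ℕ; zero; suc; _+_; _⊓_; _≤_; _<_; z≤n; s≤s; s≤s⁻¹; _≤?_; _<?_)
open import Data.Nat.Properties
open import Data.Nat.Tactic.RingSolver using (solve)
open import Data.Fin as Fin using (Fin; toℕ; fromℕ; fromℕ<; inject₁)
open import Data.Fin.Properties using (¬∀⟶∃¬; toℕ-fromℕ; toℕ-fromℕ<; toℕ-inject₁; toℕ-injective; toℕ<n)
open import Data.Fin.Subset using (Subset; _∈_; _∉_; _⊆_; _⊂_; _∪_; _∩_; ⁅_⁆; ⋃; ⊥; ⊤)
open import Data.Fin.Subset.Properties
open import Data.Vec.Properties using ([]=⇒lookup; lookup⇒[]=; lookup∘tabulate; ≡-dec)
open import Data.List using (List; []; _∷_; map; filter; allFin)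
open import Data.List.Membership.Propositional using () renaming (_∈_ to _∈ₗ_)
open import Data.List.Membership.Propositional.Properties using (∈-allFin; ∈-filter⁺)
open import Data.List.Relation.Unary.All as All using (All)
open import Data.List.Relation.Unary.All.Properties using (all-filter)
open import Data.List.Relation.Unary.Any using (here; there)
import Data.Bool as Bool
open import Data.Bool.Properties using (T-≡)
open import Data.Empty using (⊥-elim) renaming (⊥ to Empty)
open import Data.Product using (∃; _×_; _,_; proj₁; proj₂)
open import Data.Sum using (inj₁; inj₂; [_,_]′)
open import Function using (_∘_; Equivalence)
open import Relation.Nullary using (¬_; yes; no)
open import Relation.Nullary.Decidable using (toWitness; fromWitness; decidable-stable; _→-dec_)
open import Relation.Binary.PropositionalEquality
open import Relation.Binary.Construct.Closure.ReflexiveTransitive using (ε; _◅_; _◅◅_)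

module _ {n : ℕ} where

  ∪-lub : {p q s : Subset n} → p ⊆ s → q ⊆ s → p ∪ q ⊆ s
  ∪-lub {p} {q} p⊆s q⊆s = [ p⊆s , q⊆s ]′ ∘ x∈p∪q⁻ p q

  ∪-mono-⊆ : {p p′ q q′ : Subset n} → p ⊆ p′ → q ⊆ q′ → p ∪ q ⊆ p′ ∪ q′
  ∪-mono-⊆ {p′ = p′} {q′ = q′} p⊆p′ q⊆q′ =
    ∪-lub (⊆-trans p⊆p′ (p⊆p∪q q′)) (⊆-trans q⊆q′ (q⊆p∪q p′ q′))

  ∩-glb : {p q s : Subset n} → s ⊆ p → s ⊆ q → s ⊆ p ∩ q
  ∩-glb s⊆p s⊆q x∈s = x∈p∩q⁺ (s⊆p x∈s , s⊆q x∈s)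

  ⁅x⁆⊆p : {x : Fin n} {p : Subset n} → x ∈ p → ⁅ x ⁆ ⊆ p
  ⁅x⁆⊆p {x} {p} x∈p y∈⁅x⁆ = subst (_∈ p) (sym (x∈⁅y⁆⇒x≡y x y∈⁅x⁆)) x∈p

  x∈ₗxs⇒x∈⋃⁅xs⁆ : {x : Fin n} {xs : List (Fin n)} → x ∈ₗ xs → x ∈ ⋃ (map ⁅_⁆ xs)
  x∈ₗxs⇒x∈⋃⁅xs⁆ {x} (here refl) = p⊆p∪q _ (x∈⁅x⁆ x)
  x∈ₗxs⇒x∈⋃⁅xs⁆ (there x∈xs)     = q⊆p∪q _ _ (x∈ₗxs⇒x∈⋃⁅xs⁆ x∈xs)

  ∪-absorbs-⊆ : {p q s : Subset n} → q ⊆ p → p ∪ (q ∪ s) ≡ p ∪ s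
  ∪-absorbs-⊆ {s = s} q⊆p =
    ⊆-antisym (∪-lub (p⊆p∪q s) (∪-mono-⊆ q⊆p ⊆-refl)) (∪-mono-⊆ ⊆-refl (q⊆p∪q _ s))

  ⊈⇒∃∈∉ : {p q : Subset n} → ¬ (q ⊆ p) → ∃ λ x → x ∈ q × x ∉ p
  ⊈⇒∃∈∉ {p} {q} q⊈p
    with ¬∀⟶∃¬ n (λ x → x ∈ q → x ∈ p) (λ x → (x ∈? q) →-dec (x ∈? p)) (λ h → q⊈p (h _))
  ... | x , ¬[x∈q⇒x∈p] =
    x , decidable-stable (x ∈? q) (λ x∉q → ¬[x∈q⇒x∈p] (⊥-elim ∘ x∉q))
      , λ x∈p → ¬[x∈q⇒x∈p] (λ _ → x∈p)

-- The arithmetic of ∩-isModularFlat: its five modularity equations added up, with every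
-- term kept on the side where it is not subtracted.
meet-modularity-arithmetic : ∀ {x y z x∪y x∪z x∩z xz∪y m m∩z m∪z x∩b x∩p} →
  x + y ≡ x∪y + m → x + z ≡ x∪z + x∩z → y + x∩z ≡ xz∪y + m∩z →
  x + xz∪y ≡ x∪y + x∩b → x + m∪z ≡ x∪z + x∩p → x∩b ≤ x∩p →
  m + z ≤ m∪z + m∩z
meet-modularity-arithmetic {x} {y} {z} {x∪y} {x∪z} {x∩z} {xz∪y} {m} {m∩z} {m∪z} {x∩b} {x∩p}
                           eXY eXZ eY-XZ eXB eXP x∩b≤x∩p =
  +-cancelʳ-≤ (x∪y + x) _ _ (begin
    (m + z) + (x∪y + x)            ≡⟨ solve (m ∷ z ∷ x∪y ∷ x ∷ []) ⟩
    (x∪y + m) + (x + z)            ≡⟨ cong₂ _+_ (sym eXY) eXZ ⟩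
    (x + y) + (x∪z + x∩z)          ≡⟨ solve (x ∷ y ∷ x∪z ∷ x∩z ∷ []) ⟩
    (x + x∪z) + (y + x∩z)          ≡⟨ cong (x + x∪z +_) eY-XZ ⟩
    (x + x∪z) + (xz∪y + m∩z)       ≡⟨ solve (x ∷ x∪z ∷ xz∪y ∷ m∩z ∷ []) ⟩
    (x + xz∪y) + (x∪z + m∩z)       ≡⟨ cong (_+ (x∪z + m∩z)) eXB ⟩
    (x∪y + x∩b) + (x∪z + m∩z)      ≤⟨ +-monoˡ-≤ (x∪z + m∩z) (+-monoʳ-≤ x∪y x∩b≤x∩p) ⟩
    (x∪y + x∩p) + (x∪z + m∩z)      ≡⟨ solve (x∪y ∷ x∩p ∷ x∪z ∷ m∩z ∷ []) ⟩
    (x∪z + x∩p) + (x∪y + m∩z)      ≡⟨ cong (_+ (x∪y + m∩z)) (sym eXP) ⟩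
    (x + m∪z) + (x∪y + m∩z)        ≡⟨ solve (x ∷ m∪z ∷ x∪y ∷ m∩z ∷ []) ⟩
    (m∪z + m∩z) + (x∪y + x)        ∎)
  where open ≤-Reasoning

module MatroidProperties {n : ℕ} (M : Matroid n) where
  open Matroid M
  open ≤-Reasoning

  r-⊥ : r ⊥ ≡ 0
  r-⊥ = n≤0⇒n≡0 (≤-trans (r-bounded ⊥) (≤-reflexive (∣⊥∣≡0 n)))

  r-∪⁅⁆ : ∀ X e → r (X ∪ ⁅ e ⁆) ≤ suc (r X)
  r-∪⁅⁆ X e = begin
    r (X ∪ ⁅ e ⁆)                  ≤⟨ m≤m+n _ _ ⟩
    r (X ∪ ⁅ e ⁆) + r (X ∩ ⁅ e ⁆)  ≤⟨ r-submod X ⁅ e ⁆ ⟩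
    r X + r ⁅ e ⁆                  ≤⟨ +-monoʳ-≤ (r X) (≤-trans (r-bounded ⁅ e ⁆) (≤-reflexive (∣⁅x⁆∣≡1 e))) ⟩
    r X + 1                        ≡⟨ +-comm (r X) 1 ⟩
    suc (r X)                      ∎

  r-∪-absorbed-mono : ∀ {X Y A} → X ⊆ Y → r (X ∪ A) ≤ r X → r (Y ∪ A) ≤ r Y
  r-∪-absorbed-mono {X} {Y} {A} X⊆Y absorbed = +-cancelʳ-≤ (r X) _ _ (begin
    r (Y ∪ A) + r X                    ≤⟨ +-mono-≤ (r-mono (∪-mono-⊆ ⊆-refl (q⊆p∪q X A)))
                                                   (r-mono (∩-glb X⊆Y (p⊆p∪q A))) ⟩
    r (Y ∪ (X ∪ A)) + r (Y ∩ (X ∪ A))  ≤⟨ r-submod Y (X ∪ A) ⟩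
    r Y + r (X ∪ A)                    ≤⟨ +-monoʳ-≤ (r Y) absorbed ⟩
    r Y + r X                          ∎)

  r-∪-⋃⁅⁆ : ∀ X xs → All (λ e → r (X ∪ ⁅ e ⁆) ≤ r X) xs → r (X ∪ ⋃ (map ⁅_⁆ xs)) ≤ r X
  r-∪-⋃⁅⁆ X []       All.[]          = ≤-reflexive (cong r (∪-identityʳ X))
  r-∪-⋃⁅⁆ X (e ∷ xs) (abs All.∷ all) = begin
    r (X ∪ (⁅ e ⁆ ∪ ⋃ (map ⁅_⁆ xs)))  ≡⟨ cong r (sym (∪-assoc X _ _)) ⟩
    r ((X ∪ ⁅ e ⁆) ∪ ⋃ (map ⁅_⁆ xs))  ≤⟨ r-∪-absorbed-mono (p⊆p∪q _) (r-∪-⋃⁅⁆ X xs all) ⟩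
    r (X ∪ ⁅ e ⁆)                     ≤⟨ abs ⟩
    r X                               ∎

  r-∪-absorbed : ∀ X S → (∀ {e} → e ∈ S → r (X ∪ ⁅ e ⁆) ≤ r X) → r (X ∪ S) ≤ r X
  r-∪-absorbed X S absorbed = ≤-trans (r-mono (∪-mono-⊆ ⊆-refl S⊆⋃))
    (r-∪-⋃⁅⁆ X elems (All.map absorbed (all-filter (_∈? S) (allFin n))))
    where
    elems : List (Fin n)
    elems = filter (_∈? S) (allFin n)
    S⊆⋃ : S ⊆ ⋃ (map ⁅_⁆ elems)
    S⊆⋃ e∈S = x∈ₗxs⇒x∈⋃⁅xs⁆ (∈-filter⁺ (_∈? S) (∈-allFin _) e∈S)

  ∈-cl⁻ : ∀ {X e} → e ∈ cl M X → r (X ∪ ⁅ e ⁆) ≡ r X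
  ∈-cl⁻ {X} {e} e∈cl =
    toWitness (Equivalence.from T-≡ (trans (sym (lookup∘tabulate _ e)) ([]=⇒lookup e∈cl)))

  ∈-cl⁺ : ∀ {X e} → r (X ∪ ⁅ e ⁆) ≡ r X → e ∈ cl M X
  ∈-cl⁺ {X} {e} eq =
    lookup⇒[]= e (cl M X) (trans (lookup∘tabulate _ e) (Equivalence.to T-≡ (fromWitness eq)))

  X⊆cl : ∀ X → X ⊆ cl M X
  X⊆cl X e∈X = ∈-cl⁺ (cong r (⊆-antisym (∪-lub ⊆-refl (⁅x⁆⊆p e∈X)) (p⊆p∪q _)))

  ∉cl⇒r< : ∀ {X e} → e ∉ cl M X → r X < r (X ∪ ⁅ e ⁆)
  ∉cl⇒r< e∉cl = ≤∧≢⇒< (r-mono (p⊆p∪q _)) (e∉cl ∘ ∈-cl⁺ ∘ sym)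

  r-cl : ∀ X → r (cl M X) ≡ r X
  r-cl X = ≤-antisym
    (≤-trans (r-mono (q⊆p∪q X _)) (r-∪-absorbed X (cl M X) (≤-reflexive ∘ ∈-cl⁻)))
    (r-mono (X⊆cl X))

  r-∪-cl : ∀ A B → r (A ∪ cl M B) ≡ r (A ∪ B)
  r-∪-cl A B = ≤-antisym
    (≤-trans (r-mono (∪-mono-⊆ (p⊆p∪q B) ⊆-refl))
      (r-∪-absorbed (A ∪ B) (cl M B) (r-∪-absorbed-mono (q⊆p∪q A B) ∘ ≤-reflexive ∘ ∈-cl⁻)))
    (r-mono (∪-mono-⊆ ⊆-refl (X⊆cl B)))

  cl-least : ∀ {X F} → IsFlat M F → X ⊆ F → cl M X ⊆ F
  cl-least {X} {F} F-flat X⊆F {e} e∈cl with e ∈? F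
  ... | yes e∈F = e∈F
  ... | no  e∉F = ⊥-elim (<⇒≱ (F-flat e e∉F) (r-∪-absorbed-mono X⊆F (≤-reflexive (∈-cl⁻ e∈cl))))

  cl-isFlat : ∀ X → IsFlat M (cl M X)
  cl-isFlat X e e∉cl = begin-strict
    r (cl M X)          ≡⟨ r-cl X ⟩
    r X                 <⟨ ∉cl⇒r< e∉cl ⟩
    r (X ∪ ⁅ e ⁆)       ≤⟨ r-mono (∪-mono-⊆ (X⊆cl X) ⊆-refl) ⟩
    r (cl M X ∪ ⁅ e ⁆)  ∎

  ∩-isFlat : ∀ {F G} → IsFlat M F → IsFlat M G → IsFlat M (F ∩ G)
  ∩-isFlat F-flat G-flat e e∉F∩G =
    ∉cl⇒r< (e∉F∩G ∘ ∩-glb (cl-least F-flat (p∩q⊆p _ _)) (cl-least G-flat (p∩q⊆q _ _)))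

  flat-r< : ∀ {F G x} → IsFlat M F → F ⊆ G → x ∈ G → x ∉ F → r F < r G
  flat-r< F-flat F⊆G x∈G x∉F = <-≤-trans (F-flat _ x∉F) (r-mono (∪-lub F⊆G (⁅x⁆⊆p x∈G)))

  flat-⊇ : ∀ {F G} → IsFlat M F → F ⊆ G → r G ≤ r F → G ⊆ F
  flat-⊇ {F} F-flat F⊆G rG≤rF {x} x∈G with x ∈? F
  ... | yes x∈F = x∈F
  ... | no  x∉F = ⊥-elim (<⇒≱ (flat-r< F-flat F⊆G x∈G x∉F) rG≤rF)

  covers⇒r≡1+r : ∀ {F G} → IsFlat M F → IsFlat M G → Covers M F G → r G ≡ suc (r F)
  covers⇒r≡1+r {F} {G} F-flat G-flat ((F⊆G , e , e∈G , e∉F) , nothing-between) =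
    ≤-antisym rG≤1+rF (flat-r< F-flat F⊆G e∈G e∉F)
    where
    T : Subset n
    T = cl M (F ∪ ⁅ e ⁆)
    F⊂T : F ⊂ T
    F⊂T = ⊆-trans (p⊆p∪q _) (X⊆cl _) , e , X⊆cl _ (q⊆p∪q F _ (x∈⁅x⁆ e)) , e∉F
    T⊆G : T ⊆ G
    T⊆G = cl-least G-flat (∪-lub F⊆G (⁅x⁆⊆p e∈G))
    G⊆T : G ⊆ T
    G⊆T {x} x∈G with x ∈? T
    ... | yes x∈T = x∈T
    ... | no  x∉T = ⊥-elim (nothing-between T (cl-isFlat _) F⊂T (T⊆G , x , x∈G , x∉T))
    rG≤1+rF : r G ≤ suc (r F)
    rG≤1+rF = begin
      r G            ≤⟨ r-mono G⊆T ⟩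
      r T            ≡⟨ r-cl _ ⟩
      r (F ∪ ⁅ e ⁆)  ≤⟨ r-∪⁅⁆ F e ⟩
      suc (r F)      ∎

  r≡1+r⇒covers : ∀ {F G} → IsFlat M F → IsFlat M G → F ⊆ G → r G ≡ suc (r F) → Covers M F G
  r≡1+r⇒covers {F} {G} F-flat G-flat F⊆G rG≡1+rF = (F⊆G , ⊈⇒∃∈∉ G⊈F) , nothing-between
    where
    G⊈F : ¬ (G ⊆ F)
    G⊈F G⊆F = <⇒≱ (≤-reflexive (sym rG≡1+rF)) (r-mono G⊆F)
    nothing-between : ∀ H → IsFlat M H → F ⊂ H → H ⊂ G → Empty
    nothing-between H H-flat (F⊆H , x , x∈H , x∉F) (H⊆G , y , y∈G , y∉H) =
      <⇒≱ (flat-r< F-flat F⊆H x∈H x∉F) (s≤s⁻¹ (subst (r H <_) rG≡1+rF (flat-r< H-flat H⊆G y∈G y∉H)))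

  modular-∪ : ∀ {F G} → IsModularFlat M F → IsFlat M G → r F + r G ≡ r (F ∪ G) + r (F ∩ G)
  modular-∪ {F} {G} (_ , modular) G-flat = trans (modular G G-flat) (cong (_+ r (F ∩ G)) (r-cl (F ∪ G)))

  modular-law : ∀ {Y A C} → IsModularFlat M Y → IsFlat M A → IsFlat M C → A ⊆ C →
                cl M (A ∪ Y) ∩ C ⊆ cl M (A ∪ (Y ∩ C))
  modular-law {Y} {A} {C} Y-mod A-flat C-flat A⊆C = flat-⊇ (cl-isFlat _) R⊆L (+-cancelˡ-≤ (r Y) _ _ rY+rL≤rY+rR)
    where
    L R : Subset n
    L = cl M (A ∪ Y) ∩ C
    R = cl M (A ∪ (Y ∩ C))
    R⊆L : R ⊆ L
    R⊆L = cl-least (∩-isFlat (cl-isFlat _) C-flat)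
      (∪-lub (∩-glb (⊆-trans (p⊆p∪q Y) (X⊆cl _)) A⊆C)
             (∩-glb (⊆-trans (p∩q⊆p Y C) (⊆-trans (q⊆p∪q A Y) (X⊆cl _))) (p∩q⊆q Y C)))
    rY+rL≤rY+rR : r Y + r L ≤ r Y + r R
    rY+rL≤rY+rR = begin
      r Y + r L                 ≡⟨ modular-∪ Y-mod (∩-isFlat (cl-isFlat _) C-flat) ⟩
      r (Y ∪ L) + r (Y ∩ L)     ≤⟨ +-mono-≤ r[Y∪L]≤r[Y∪R] (r-mono Y∩L⊆Y∩R) ⟩
      r (Y ∪ R) + r (Y ∩ R)     ≡⟨ sym (modular-∪ Y-mod (cl-isFlat _)) ⟩
      r Y + r R                 ∎
      where
      Y∩L⊆Y∩R : Y ∩ L ⊆ Y ∩ R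
      Y∩L⊆Y∩R = ∩-glb (p∩q⊆p _ _) (⊆-trans (∩-glb (p∩q⊆p _ _) (⊆-trans (p∩q⊆q _ _) (p∩q⊆q _ _)))
                                            (⊆-trans (q⊆p∪q A _) (X⊆cl _)))
      r[Y∪L]≤r[Y∪R] : r (Y ∪ L) ≤ r (Y ∪ R)
      r[Y∪L]≤r[Y∪R] = begin
        r (Y ∪ L)                ≤⟨ r-mono (∪-lub (⊆-trans (q⊆p∪q A Y) (X⊆cl _)) (p∩q⊆p _ _)) ⟩
        r (cl M (A ∪ Y))         ≡⟨ r-cl _ ⟩
        r (A ∪ Y)                ≤⟨ r-mono (∪-lub (⊆-trans (p⊆p∪q _) (q⊆p∪q Y _)) (p⊆p∪q _)) ⟩
        r (Y ∪ (A ∪ (Y ∩ C)))    ≡⟨ sym (r-∪-cl Y _) ⟩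
        r (Y ∪ R)                ∎

  modular-cl : ∀ {X} → IsModularFlat M X → ∀ S → r X + r S ≡ r (X ∪ S) + r (X ∩ cl M S)
  modular-cl {X} X-mod S = begin-equality
    r X + r S                     ≡⟨ cong (r X +_) (r-cl S) ⟨
    r X + r (cl M S)              ≡⟨ modular-∪ X-mod (cl-isFlat S) ⟩
    r (X ∪ cl M S) + r (X ∩ cl M S)  ≡⟨ cong (_+ r (X ∩ cl M S)) (r-∪-cl X S) ⟩
    r (X ∪ S) + r (X ∩ cl M S)    ∎

  ∩-isModularFlat : ∀ {X Y} → IsModularFlat M X → IsModularFlat M Y → IsModularFlat M (X ∩ Y)
  ∩-isModularFlat {X} {Y} X-mod@(X-flat , _) Y-mod@(Y-flat , _) = ∩-isFlat X-flat Y-flat , m-modular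
    where
    m : Subset n
    m = X ∩ Y
    m-modular : ∀ Z → IsFlat M Z → r m + r Z ≡ r (cl M (m ∪ Z)) + r (m ∩ Z)
    m-modular Z Z-flat = trans (≤-antisym supermodular (r-submod m Z)) (cong (_+ r (m ∩ Z)) (sym (r-cl _)))
      where
      B P : Subset n
      B = cl M ((X ∩ Z) ∪ Y)
      P = cl M (m ∪ Z)
      eY-XZ : r Y + r (X ∩ Z) ≡ r ((X ∩ Z) ∪ Y) + r (m ∩ Z)
      eY-XZ = trans (modular-∪ Y-mod (∩-isFlat X-flat Z-flat))
                    (cong₂ (λ S T → r S + r T) (∪-comm Y (X ∩ Z))
                           (trans (sym (∩-assoc Y X Z)) (cong (_∩ Z) (∩-comm Y X))))
      eXB : r X + r ((X ∩ Z) ∪ Y) ≡ r (X ∪ Y) + r (X ∩ B)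
      eXB = trans (modular-cl X-mod _) (cong (λ S → r S + r (X ∩ B)) (∪-absorbs-⊆ (p∩q⊆p X Z)))
      eXP : r X + r (m ∪ Z) ≡ r (X ∪ Z) + r (X ∩ P)
      eXP = trans (modular-cl X-mod _) (cong (λ S → r S + r (X ∩ P)) (∪-absorbs-⊆ (p∩q⊆p X Y)))
      X∩B⊆X∩P : X ∩ B ⊆ X ∩ P
      X∩B⊆X∩P = ∩-glb (p∩q⊆p X B) (⊆-trans (∩-glb (p∩q⊆q X B) (p∩q⊆p X B))
        (⊆-trans (modular-law Y-mod (∩-isFlat X-flat Z-flat) X-flat (p∩q⊆p X Z))
                 (cl-least (cl-isFlat _) (⊆-trans XZ∪YX⊆m∪Z (X⊆cl _)))))
        where
        XZ∪YX⊆m∪Z : (X ∩ Z) ∪ (Y ∩ X) ⊆ m ∪ Z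
        XZ∪YX⊆m∪Z = ∪-lub (⊆-trans (p∩q⊆q X Z) (q⊆p∪q m Z))
                          (⊆-trans (∩-glb (p∩q⊆q Y X) (p∩q⊆p Y X)) (p⊆p∪q Z))
      supermodular : r m + r Z ≤ r (m ∪ Z) + r (m ∩ Z)
      supermodular = meet-modularity-arithmetic (modular-∪ X-mod Y-flat) (modular-∪ X-mod Z-flat)
                       eY-XZ eXB eXP (r-mono X∩B⊆X∩P)

  r-∩-step : ∀ {H F G} → IsModularFlat M H → IsFlat M F → IsFlat M G → F ⊆ G → r G ≡ suc (r F) →
            r (H ∩ G) ≤ suc (r (H ∩ F))
  r-∩-step {H} {F} {G} H-mod F-flat G-flat F⊆G rG≡1+rF = +-cancelˡ-≤ (r (H ∪ F)) _ _ (begin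
    r (H ∪ F) + r (H ∩ G)        ≤⟨ +-monoˡ-≤ (r (H ∩ G)) (r-mono (∪-mono-⊆ ⊆-refl F⊆G)) ⟩
    r (H ∪ G) + r (H ∩ G)        ≡⟨ sym (modular-∪ H-mod G-flat) ⟩
    r H + r G                    ≡⟨ cong (r H +_) rG≡1+rF ⟩
    r H + suc (r F)              ≡⟨ +-suc (r H) (r F) ⟩
    suc (r H + r F)              ≡⟨ cong suc (modular-∪ H-mod F-flat) ⟩
    suc (r (H ∪ F) + r (H ∩ F))  ≡⟨ sym (+-suc (r (H ∪ F)) (r (H ∩ F))) ⟩
    r (H ∪ F) + suc (r (H ∩ F))  ∎)

  r-∩-distinct : ∀ {F G k} → IsModularFlat M F → IsFlat M G → F ≢ G →
                 r F ≡ suc k → r G ≡ suc k → r (F ∪ G) ≤ suc (suc k) → r (F ∩ G) ≡ k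
  r-∩-distinct {F} {G} {k} F-mod@(F-flat , _) G-flat F≢G rF≡1+k rG≡1+k r[F∪G]≤2+k =
    sym (+-cancelˡ-≡ (suc (suc k)) _ _ (begin-equality
      suc (suc k) + k          ≡⟨ cong suc (sym (+-suc k k)) ⟩
      suc k + suc k            ≡⟨ sym (cong₂ _+_ rF≡1+k rG≡1+k) ⟩
      r F + r G                ≡⟨ modular-∪ F-mod G-flat ⟩
      r (F ∪ G) + r (F ∩ G)    ≡⟨ cong (_+ r (F ∩ G)) r[F∪G]≡2+k ⟩
      suc (suc k) + r (F ∩ G)  ∎))
    where
    r[F∪G]≰1+k : ¬ (r (F ∪ G) ≤ suc k)
    r[F∪G]≰1+k r[F∪G]≤1+k = F≢G (⊆-antisym F⊆G G⊆F)
      where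
      G⊆F : G ⊆ F
      G⊆F = ⊆-trans (q⊆p∪q F G)
                    (flat-⊇ F-flat (p⊆p∪q G) (≤-trans r[F∪G]≤1+k (≤-reflexive (sym rF≡1+k))))
      F⊆G : F ⊆ G
      F⊆G = flat-⊇ G-flat G⊆F (≤-reflexive (trans rF≡1+k (sym rG≡1+k)))
    r[F∪G]≡2+k : r (F ∪ G) ≡ suc (suc k)
    r[F∪G]≡2+k = ≤-antisym r[F∪G]≤2+k (≰⇒> r[F∪G]≰1+k)

punchIn : ℕ → ℕ → ℕ
punchIn p i with i <? p
... | yes _ = i
... | no  _ = suc i

punchIn-< : ∀ {p i} → i < p → punchIn p i ≡ i
punchIn-< {p} {i} i<p with i <? p
... | yes _   = refl
... | no  i≮p = ⊥-elim (i≮p i<p)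

punchIn-≥ : ∀ {p i} → p ≤ i → punchIn p i ≡ suc i
punchIn-≥ {p} {i} p≤i with i <? p
... | yes i<p = ⊥-elim (<⇒≱ i<p p≤i)
... | no  _   = refl

punchIn-≤-suc : ∀ p i → punchIn p i ≤ suc i
punchIn-≤-suc p i with i <? p
... | yes _ = n≤1+n i
... | no  _ = ≤-refl

≤-punchIn : ∀ p i → i ≤ punchIn p i
≤-punchIn p i with i <? p
... | yes _ = ≤-refl
... | no  _ = n≤1+n i

module UnitSteps (a : ℕ → ℕ) (a0≡0 : a 0 ≡ 0) (m : ℕ) (a-step : ∀ i → i < m → a (suc i) ≤ suc (a i)) where

  a≤id : ∀ i → i ≤ m → a i ≤ i
  a≤id zero    _     = ≤-reflexive a0≡0
  a≤id (suc i) 1+i≤m = ≤-trans (a-step i 1+i≤m) (s≤s (a≤id i (<⇒≤ 1+i≤m)))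

  a≡id-below : ∀ j → j ≤ m → a j ≡ j → ∀ i → i ≤ j → a i ≡ i
  a≡id-below zero    _     aj≡j .zero z≤n   = aj≡j
  a≡id-below (suc j) 1+j≤m a[1+j]≡1+j i i≤1+j with m≤n⇒m<n∨m≡n i≤1+j
  ... | inj₂ refl = a[1+j]≡1+j
  ... | inj₁ i<1+j = a≡id-below j (<⇒≤ 1+j≤m) aj≡j i (s≤s⁻¹ i<1+j)
    where
    aj≡j : a j ≡ j
    aj≡j = ≤-antisym (a≤id j (<⇒≤ 1+j≤m)) (s≤s⁻¹ (subst (_≤ suc (a j)) a[1+j]≡1+j (a-step j 1+j≤m)))

  a[k+1]≡k⇒∃[j]a∘punchIn[1+j]≡id : ∀ k → suc k ≤ m → a (suc k) ≡ k →
                                    ∃ λ j → j ≤ k × ∀ i → i ≤ k → a (punchIn (suc j) i) ≡ i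
  a[k+1]≡k⇒∃[j]a∘punchIn[1+j]≡id zero _ _ = zero , z≤n , λ { .zero z≤n → a0≡0 }
  a[k+1]≡k⇒∃[j]a∘punchIn[1+j]≡id (suc k) 2+k≤m a[2+k]≡1+k with a (suc k) ≟ suc k
  ... | yes a[1+k]≡1+k = suc k , ≤-refl , λ i i≤1+k →
    trans (cong a (punchIn-< (s≤s i≤1+k))) (a≡id-below (suc k) (<⇒≤ 2+k≤m) a[1+k]≡1+k i i≤1+k)
  ... | no a[1+k]≢1+k with a[k+1]≡k⇒∃[j]a∘punchIn[1+j]≡id k (<⇒≤ 2+k≤m) a[1+k]≡k
    where
    a[1+k]≡k : a (suc k) ≡ k
    a[1+k]≡k = ≤-antisym (s≤s⁻¹ (≤∧≢⇒< (a≤id (suc k) (<⇒≤ 2+k≤m)) a[1+k]≢1+k))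
                         (s≤s⁻¹ (subst (_≤ suc (a (suc k))) a[2+k]≡1+k (a-step (suc k) 2+k≤m)))
  ... | j , j≤k , a∘punchIn≡id = j , m≤n⇒m≤1+n j≤k , extend
    where
    extend : ∀ i → i ≤ suc k → a (punchIn (suc j) i) ≡ i
    extend i i≤1+k with m≤n⇒m<n∨m≡n i≤1+k
    ... | inj₁ i<1+k = a∘punchIn≡id i (s≤s⁻¹ i<1+k)
    ... | inj₂ refl  = trans (cong a (punchIn-≥ (s≤s j≤k))) a[2+k]≡1+k

splice : {A : Set} → ℕ → (ℕ → A) → (ℕ → A) → ℕ → A
splice k f g i with i ≤? k
... | yes _ = f i
... | no  _ = g i

splice-≤ : ∀ {A : Set} {k i} (f g : ℕ → A) → i ≤ k → splice k f g i ≡ f i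
splice-≤ {k = k} {i} f g i≤k with i ≤? k
... | yes _   = refl
... | no  i≰k = ⊥-elim (i≰k i≤k)

splice-> : ∀ {A : Set} {k i} (f g : ℕ → A) → k < i → splice k f g i ≡ g i
splice-> {k = k} {i} f g k<i with i ≤? k
... | yes i≤k = ⊥-elim (<⇒≱ k<i i≤k)
... | no  _   = refl

module Chains {n : ℕ} (M : Matroid n) where
  open Matroid M
  open MatroidProperties M

  R : ℕ
  R = rank M

  record ModularChain (k : ℕ) (T : Subset n) : Set where
    field
      flat         : ℕ → Subset n
      flat-modular : ∀ i → IsModularFlat M (flat i)
      flat-0≡⊥     : flat 0 ≡ ⊥
      flat-⊆-suc   : ∀ i → flat i ⊆ flat (suc i)
      flat-⊆       : ∀ i → flat i ⊆ T
      r-flat       : ∀ i → i ≤ k → r (flat i) ≡ i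

    flat-isFlat : ∀ i → IsFlat M (flat i)
    flat-isFlat = proj₁ ∘ flat-modular

    flat-mono : ∀ {i j} → i ≤ j → flat i ⊆ flat j
    flat-mono {j = zero}  z≤n   = ⊆-refl
    flat-mono {i} {suc j} i≤1+j with m≤n⇒m<n∨m≡n i≤1+j
    ... | inj₁ i<1+j = ⊆-trans (flat-mono (s≤s⁻¹ i<1+j)) (flat-⊆-suc j)
    ... | inj₂ refl  = ⊆-refl

    r-flat-suc : ∀ i → i < k → r (flat (suc i)) ≡ suc (r (flat i))
    r-flat-suc i i<k = trans (r-flat (suc i) i<k) (cong suc (sym (r-flat i (<⇒≤ i<k))))

  open ModularChain

  flat-R≡⊤ : (X : ModularChain R ⊤) → flat X R ≡ ⊤
  flat-R≡⊤ X = ⊆-antisym ⊆⊤ (flat-⊇ (flat-isFlat X R) ⊆⊤ (≤-reflexive (sym (r-flat X R ≤-refl))))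

  -- r (H ∩ X i) climbs from 0 to k in k + 1 steps of size ≤ 1; punchIn skips the one stall.
  meet-chain : ∀ {m T H k} (X : ModularChain m T) → IsModularFlat M H → suc k ≤ m →
              H ⊆ flat X (suc k) → r H ≡ k → ModularChain k H
  meet-chain {H = H} {k} X H-mod 1+k≤m H⊆X[1+k] rH≡k = record
    { flat         = λ i → H ∩ flat X (punchIn (suc j) i)
    ; flat-modular = λ i → ∩-isModularFlat H-mod (flat-modular X _)
    ; flat-0≡⊥     = trans (cong (H ∩_) (flat-0≡⊥ X)) (∩-zeroʳ H)
    ; flat-⊆-suc   = λ i → ∩-glb (p∩q⊆p _ _) (⊆-trans (p∩q⊆q _ _)
                       (flat-mono X (≤-trans (punchIn-≤-suc (suc j) i) (≤-punchIn (suc j) (suc i)))))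
    ; flat-⊆       = λ i → p∩q⊆p _ _
    ; r-flat       = a∘punchIn≡id
    }
    where
    a : ℕ → ℕ
    a i = r (H ∩ flat X i)
    a0≡0 : a 0 ≡ 0
    a0≡0 = n≤0⇒n≡0 (≤-trans (r-mono (p∩q⊆q _ _)) (≤-reflexive (r-flat X 0 z≤n)))
    a-step : ∀ i → i < suc k → a (suc i) ≤ suc (a i)
    a-step i i<1+k = r-∩-step H-mod (flat-isFlat X i) (flat-isFlat X (suc i)) (flat-⊆-suc X i)
                       (r-flat-suc X i (≤-trans i<1+k 1+k≤m))
    a[1+k]≡k : a (suc k) ≡ k
    a[1+k]≡k = trans (cong r (⊆-antisym (p∩q⊆p _ _) (∩-glb ⊆-refl H⊆X[1+k]))) rH≡k
    open UnitSteps a a0≡0 (suc k) a-step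
    stall : ∃ λ j → j ≤ k × ∀ i → i ≤ k → a (punchIn (suc j) i) ≡ i
    stall = a[k+1]≡k⇒∃[j]a∘punchIn[1+j]≡id k ≤-refl a[1+k]≡k
    j : ℕ
    j = proj₁ stall
    a∘punchIn≡id : ∀ i → i ≤ k → a (punchIn (suc j) i) ≡ i
    a∘punchIn≡id = proj₂ (proj₂ stall)

  graft : ∀ {m T k S} (X : ModularChain m T) → S ⊆ flat X (suc k) → ModularChain k S → ModularChain m T
  graft {m} {T} {k} X S⊆X[1+k] E = record
    { flat         = splice k (flat E) (flat X)
    ; flat-modular = modular-grafted
    ; flat-0≡⊥     = flat-0≡⊥ E
    ; flat-⊆-suc   = ⊆-suc-grafted
    ; flat-⊆       = ⊆-grafted
    ; r-flat       = r-grafted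
    }
    where
    modular-grafted : ∀ i → IsModularFlat M (splice k (flat E) (flat X) i)
    modular-grafted i with i ≤? k
    ... | yes _ = flat-modular E i
    ... | no  _ = flat-modular X i
    ⊆-suc-grafted : ∀ i → splice k (flat E) (flat X) i ⊆ splice k (flat E) (flat X) (suc i)
    ⊆-suc-grafted i with i ≤? k | suc i ≤? k
    ... | yes _   | yes _     = flat-⊆-suc E i
    ... | yes _   | no 1+i≰k  = ⊆-trans (flat-⊆ E i) (⊆-trans S⊆X[1+k] (flat-mono X (≰⇒> 1+i≰k)))
    ... | no i≰k  | yes 1+i≤k = ⊥-elim (i≰k (<⇒≤ 1+i≤k))
    ... | no _    | no _      = flat-⊆-suc X i
    ⊆-grafted : ∀ i → splice k (flat E) (flat X) i ⊆ T
    ⊆-grafted i with i ≤? k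
    ... | yes _ = ⊆-trans (flat-⊆ E i) (⊆-trans S⊆X[1+k] (flat-⊆ X (suc k)))
    ... | no  _ = flat-⊆ X i
    r-grafted : ∀ i → i ≤ m → r (splice k (flat E) (flat X) i) ≡ i
    r-grafted i i≤m with i ≤? k
    ... | yes i≤k = r-flat E i i≤k
    ... | no  _   = r-flat X i i≤m

  toMChain : ModularChain R ⊤ → MChain M
  toMChain X = record
    { F        = flat X ∘ toℕ
    ; modular  = flat-modular X ∘ toℕ
    ; bottom   = flat-0≡⊥ X
    ; top      = trans (cong (flat X) (toℕ-fromℕ R)) (flat-R≡⊤ X)
    ; covering = λ i → subst (λ j → Covers M (flat X j) (flat X (suc (toℕ i)))) (sym (toℕ-inject₁ i))
                   (r≡1+r⇒covers (flat-isFlat X _) (flat-isFlat X _) (flat-⊆-suc X _) (r-flat-suc X _ (toℕ<n i)))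
    }

  clamp : ℕ → Fin (suc R)
  clamp m = fromℕ< (s≤s (m⊓n≤n m R))

  toℕ-clamp : ∀ {m} → m ≤ R → toℕ (clamp m) ≡ m
  toℕ-clamp m≤R = trans (toℕ-fromℕ< _) (m≤n⇒m⊓n≡m m≤R)

  clamp-≥ : ∀ {m} → R ≤ m → clamp m ≡ fromℕ R
  clamp-≥ R≤m = toℕ-injective (trans (toℕ-fromℕ< _) (trans (m≥n⇒m⊓n≡n R≤m) (sym (toℕ-fromℕ R))))

  clamp-toℕ : ∀ i → clamp (toℕ i) ≡ i
  clamp-toℕ i = toℕ-injective (toℕ-clamp (s≤s⁻¹ (toℕ<n i)))

  fromMChain : MChain M → ModularChain R ⊤
  fromMChain C = record
    { flat         = F C ∘ clamp
    ; flat-modular = modular C ∘ clamp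
    ; flat-0≡⊥     = bottom C
    ; flat-⊆-suc   = ⊆-suc
    ; flat-⊆       = λ _ → ⊆⊤
    ; r-flat       = rank-clamp
    }
    where
    covers-clamp : ∀ i → i < R → Covers M (F C (clamp i)) (F C (clamp (suc i)))
    covers-clamp i i<R = subst₂ (Covers M) (cong (F C) inject₁j≡clamp[i]) (cong (F C) 1+j≡clamp[1+i]) (covering C j)
      where
      j = fromℕ< i<R
      inject₁j≡clamp[i] : inject₁ j ≡ clamp i
      inject₁j≡clamp[i] =
        toℕ-injective (trans (toℕ-inject₁ j) (trans (toℕ-fromℕ< i<R) (sym (toℕ-clamp (<⇒≤ i<R)))))
      1+j≡clamp[1+i] : Fin.suc j ≡ clamp (suc i)
      1+j≡clamp[1+i] = toℕ-injective (trans (cong suc (toℕ-fromℕ< i<R)) (sym (toℕ-clamp i<R)))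
    ⊆-suc : ∀ i → F C (clamp i) ⊆ F C (clamp (suc i))
    ⊆-suc i with i <? R
    ... | yes i<R = proj₁ (proj₁ (covers-clamp i i<R))
    ... | no  i≮R =
      ⊆-trans ⊆⊤ (⊆-reflexive (sym (trans (cong (F C) (clamp-≥ (m≤n⇒m≤1+n (≮⇒≥ i≮R)))) (top C))))
    rank-clamp : ∀ i → i ≤ R → r (F C (clamp i)) ≡ i
    rank-clamp zero    _     = trans (cong r (bottom C)) r-⊥
    rank-clamp (suc i) 1+i≤R =
      trans (covers⇒r≡1+r (proj₁ (modular C _)) (proj₁ (modular C _)) (covers-clamp i 1+i≤R))
            (cong suc (rank-clamp i (<⇒≤ 1+i≤R)))

  AgreeAbove : ℕ → ModularChain R ⊤ → ModularChain R ⊤ → Set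
  AgreeAbove k X Y = ∀ m → k < m → m ≤ R → flat X m ≡ flat Y m

  agree-except⇒deformation : ∀ {X Y} j → j ≤ R → (∀ m → m ≢ j → m ≤ R → flat X m ≡ flat Y m) →
                            ElementaryDeformation M (toMChain X) (toMChain Y)
  agree-except⇒deformation j j≤R agree-off =
    fromℕ< (s≤s j≤R) , λ i i≢j → agree-off (toℕ i) (i≢j ∘ toℕ-injective ∘ toℕ≡j⇒) (s≤s⁻¹ (toℕ<n i))
    where
    toℕ≡j⇒ : ∀ {i} → toℕ i ≡ j → toℕ i ≡ toℕ (fromℕ< (s≤s j≤R))
    toℕ≡j⇒ eq = trans eq (sym (toℕ-fromℕ< _))

  agree-above-extend : ∀ {k X Y} → AgreeAbove (suc k) X Y → (suc k ≤ R → flat X (suc k) ≡ flat Y (suc k)) →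
                     AgreeAbove k X Y
  agree-above-extend agree agree-at-1+k m k<m m≤R with m≤n⇒m<n∨m≡n k<m
  ... | inj₁ 1+k<m = agree m 1+k<m m≤R
  ... | inj₂ refl  = agree-at-1+k m≤R

  exchange : ∀ {k} X Y → suc k < R → flat X (suc k) ≢ flat Y (suc k) → AgreeAbove (suc k) X Y →
             ∃ λ X′ → ∃ λ Y′ →
               AgreeAbove k X X′ × ElementaryDeformation M (toMChain X′) (toMChain Y′) × AgreeAbove k Y′ Y
  exchange {k} X Y 1+k<R X≢Y agree =
      X′ , Y′
    , (λ m k<m _ → sym (splice-> (flat E) (flat X) k<m))
    , agree-except⇒deformation {X′} {Y′} (suc k) (<⇒≤ 1+k<R) agree-off
    , (λ m k<m _ → splice-> (flat E) (flat Y) k<m)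
    where
    K : ℕ
    K = suc k
    H : Subset n
    H = flat X K ∩ flat Y K
    H-mod : IsModularFlat M H
    H-mod = ∩-isModularFlat (flat-modular X K) (flat-modular Y K)
    X[K]∪Y[K]⊆X[1+K] : flat X K ∪ flat Y K ⊆ flat X (suc K)
    X[K]∪Y[K]⊆X[1+K] =
      ∪-lub (flat-⊆-suc X K) (⊆-trans (flat-⊆-suc Y K) (⊆-reflexive (sym (agree (suc K) ≤-refl 1+k<R))))
    rH≡k : r H ≡ k
    rH≡k = r-∩-distinct (flat-modular X K) (flat-isFlat Y K) X≢Y (r-flat X K (<⇒≤ 1+k<R)) (r-flat Y K (<⇒≤ 1+k<R))
             (≤-trans (r-mono X[K]∪Y[K]⊆X[1+K]) (≤-reflexive (r-flat X (suc K) 1+k<R)))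
    E : ModularChain k H
    E = meet-chain {H = H} {k = k} X H-mod (<⇒≤ 1+k<R) (p∩q⊆p (flat X K) (flat Y K)) rH≡k
    X′ Y′ : ModularChain R ⊤
    X′ = graft X (p∩q⊆p _ _) E
    Y′ = graft Y (p∩q⊆q _ _) E
    agree-off : ∀ m → m ≢ K → m ≤ R → splice k (flat E) (flat X) m ≡ splice k (flat E) (flat Y) m
    agree-off m m≢K m≤R = [ below , above ]′ (≤-<-connex m k)
      where
      below : m ≤ k → splice k (flat E) (flat X) m ≡ splice k (flat E) (flat Y) m
      below m≤k = trans (splice-≤ (flat E) (flat X) m≤k) (sym (splice-≤ (flat E) (flat Y) m≤k))
      above : k < m → splice k (flat E) (flat X) m ≡ splice k (flat E) (flat Y) m
      above k<m = begin
        splice k (flat E) (flat X) m  ≡⟨ splice-> (flat E) (flat X) k<m ⟩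
        flat X m                      ≡⟨ agree m (≤∧≢⇒< k<m (m≢K ∘ sym)) m≤R ⟩
        flat Y m                      ≡⟨ splice-> (flat E) (flat Y) k<m ⟨
        splice k (flat E) (flat Y) m  ∎
        where open ≡-Reasoning

  agree-above⇒equivalent : ∀ k X Y → AgreeAbove k X Y → Equivalent M (toMChain X) (toMChain Y)
  agree-above⇒equivalent zero X Y agree =
    agree-except⇒deformation {X} {Y} 0 z≤n (λ m m≢0 → agree m (n≢0⇒n>0 m≢0)) ◅ ε
  agree-above⇒equivalent (suc k) X Y agree with suc k <? R
  ... | no 1+k≮R = agree-above⇒equivalent k X Y (agree-above-extend {k} {X} {Y} agree agree-at-top)
    where
    agree-at-top : suc k ≤ R → flat X (suc k) ≡ flat Y (suc k)
    agree-at-top 1+k≤R rewrite ≤-antisym 1+k≤R (≮⇒≥ 1+k≮R) = trans (flat-R≡⊤ X) (sym (flat-R≡⊤ Y))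
  ... | yes 1+k<R with ≡-dec Bool._≟_ (flat X (suc k)) (flat Y (suc k))
  ...   | yes X≡Y = agree-above⇒equivalent k X Y (agree-above-extend {k} {X} {Y} agree (λ _ → X≡Y))
  ...   | no  X≢Y =
    let X′ , Y′ , X≈X′ , X′~Y′ , Y′≈Y = exchange X Y 1+k<R X≢Y agree
    in agree-above⇒equivalent k X X′ X≈X′ ◅◅ X′~Y′ ◅ agree-above⇒equivalent k Y′ Y Y′≈Y

  F-toMChain∘fromMChain : ∀ C i → F (toMChain (fromMChain C)) i ≡ F C i
  F-toMChain∘fromMChain C i = cong (F C) (clamp-toℕ i)

  M-chains-equivalent : ∀ C C′ → Equivalent M C C′
  M-chains-equivalent C C′ =
    (Fin.zero , λ i _ → sym (F-toMChain∘fromMChain C i))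
      ◅ agree-above⇒equivalent R (fromMChain C) (fromMChain C′) nothing-above-R
      ◅◅ (Fin.zero , λ i _ → F-toMChain∘fromMChain C′ i) ◅ ε
    where
    nothing-above-R : AgreeAbove R (fromMChain C) (fromMChain C′)
    nothing-above-R m R<m m≤R = ⊥-elim (<⇒≱ R<m m≤R)

proposition2p11 : (n : ℕ) (M : Matroid n) → Supersolvable M →
    (C C' : MChain M) → Equivalent M C C'
-- Supersolvability only asserts that some M-chain exists.
proposition2p11 n M _ = Chains.M-chains-equivalent M
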